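{- The constraint graph $F$ is identifiable.
   Context: $F$ is the constraint graph with vertex set $I_{32}\cup\{1,2,3,4\}$, where $I_{32}$ is a set of 32 vertices forming an independent set, every vertex of $I_{32}$ is adjacent to each of $1,2,3,4$, and additionally $\{1,2\},\{2,3\},\{3,4\}$ are edges; there are no other edges and no self-loops. An $F$-coloring of a graph $G=(V,E)$ is a map $\sigma:V\to V(F)$ with $\{\sigma(x),\sigma(y)\}\in E(F)$ for all $\{x,y\}\in E$; $\pi_G$ is the uniform distribution on the $F$-colorings of $G$. $F$ is identifiable if any two distinct finite $F$-colorable graphs $G_1,G_2$ on the same vertex set satisfy $\pi_{G_1}\neq\pi_{G_2}$. -}

module Defs where

open import Data.Nat using (ℕ; zero; suc; _<ᵇ_; _≡ᵇ_)
open import Data.Fin using (Fin; toℕ)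
open import Data.Fin.Base using () renaming (zero to fz)
open import Data.Bool using (Bool; true; false; _∧_; _∨_; not; if_then_else_)
open import Data.List using (List; []; _∷_; map; concatMap; length; filter; allFin)
open import Data.Bool.ListAction using (all)
open import Data.Vec.Functional as VF using ()
open import Data.Integer using (+_)
open import Data.Rational using (ℚ; 0ℚ; _/_)
open import Relation.Binary.PropositionalEquality using (_≡_)
open import Relation.Nullary.Decidable using (T?)

-- The constraint graph F on 36 vertices:
--   0 .. 31  : the independent set I_32
--   32,33,34,35 : the vertices 1,2,3,4
VF : Set
VF = Fin 36

private
  isI : ℕ → Bool
  isI a = a <ᵇ 32

  path : ℕ → ℕ → Bool
  path a b = ((a ≡ᵇ 32) ∧ (b ≡ᵇ 33)) ∨ ((a ≡ᵇ 33) ∧ (b ≡ᵇ 34)) ∨ ((a ≡ᵇ 34) ∧ (b ≡ᵇ 35))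

FAdj : VF → VF → Bool
FAdj u v =
  (isI a ∧ not (isI b)) ∨ (isI b ∧ not (isI a)) ∨ path a b ∨ path b a
  where
  a = toℕ u
  b = toℕ v

record Graph (n : ℕ) : Set where
  field
    adj   : Fin n → Fin n → Bool
    sym   : ∀ x y → adj x y ≡ adj y x
    irref : ∀ x → adj x x ≡ false
open Graph public

Map : ℕ → Set
Map n = Fin n → VF

isColoring : ∀ {n} → Graph n → Map n → Bool
isColoring {n} G σ =
  all (λ x → all (λ y → not (adj G x y) ∨ FAdj (σ x) (σ y)) (allFin n)) (allFin n)

allMaps : ∀ n → List (Map n)
allMaps zero = (λ ()) ∷ []
allMaps (suc n) = concatMap (λ c → map (λ f → c VF.∷ f) (allMaps n)) (allFin 36)

numColorings : ∀ {n} → Graph n → ℕ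
numColorings {n} G = length (filter (λ σ → T? (isColoring G σ)) (allMaps n))

FColorable : ∀ {n} → Graph n → Set
FColorable G = Data.Product.Σ _ (λ σ → isColoring G σ ≡ true)
  where import Data.Product

-- uniform distribution on the F-colorings of G (probability mass function on maps).
-- (When G has no F-coloring the value is set to 0; only used for F-colorable G.)
π : ∀ {n} → Graph n → Map n → ℚ
π G σ with numColorings G
... | zero  = 0ℚ
... | suc k = if isColoring G σ then (+ 1) / suc k else 0ℚ

SameGraph : ∀ {n} → Graph n → Graph n → Set
SameGraph {n} G₁ G₂ = ∀ (x y : Fin n) → adj G₁ x y ≡ adj G₂ x y

Identifiable : Set
Identifiable =
  ∀ (n : ℕ) (G₁ G₂ : Graph n) → FColorable G₁ → FColorable G₂ →
  (SameGraph G₁ G₂ → Data.Empty.⊥) →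
  ((∀ σ → π G₁ σ ≡ π G₂ σ) → Data.Empty.⊥)
  where import Data.Empty

-- If π G ≗ π H and H is F-colorable, then every F-coloring of H is an F-coloring of G (the
-- value 1/#colorings of H is nonzero, while π G vanishes off the colorings of G).  So it is
-- enough that every non-edge xy of an F-colorable graph H is separated: some F-coloring of H
-- sends x and y to non-adjacent vertices of F.  F maps homomorphically onto the triangle K₃
-- (I ↦ 0, {1,3} ↦ 1, {2,4} ↦ 2), so H has a proper 3-coloring c.  If c x = c y, composing c
-- with an embedding of K₃ into F works.  Otherwise send x ↦ 4, y ↦ 1 and every other vertex v
-- to 2, 3 or a vertex of I according as c v is c x, c y or the third color: a neighbour of x
-- has color ≠ c x, so it lands on 3 or I, both adjacent to 4; symmetrically for y and 1.
module Submission where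

open import Defs hiding (sym)
open import Data.Nat using (zero; suc; _<_; _<ᵇ_; _≡ᵇ_)
open import Data.Fin as Fin using (Fin; #_; _≟_; toℕ)
open import Data.Fin.Properties using (all?)
open import Data.Bool using (Bool; true; false; _∨_; not; if_then_else_; T)
import Data.Bool.Properties as Bool
open import Data.Bool.ListAction using (all)
open import Data.List using (List; []; _∷_; map; allFin)
open import Data.List.Membership.Propositional using (_∈_)
open import Data.List.Membership.Propositional.Properties
  using (∈-allFin; ∈-map⁺; ∈-concatMap⁺; ∈-filter⁺; ∈-length)
open import Data.List.Relation.Unary.Any using (here; there)
import Data.List.Relation.Unary.Any as Any
open import Data.Sum using (_⊎_; inj₁; inj₂)
open import Data.Product using (∃; _×_; _,_)
open import Data.Rational using (0ℚ; _/_)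
open import Data.Rational.Properties using (↥-/)
open import Data.Integer using (+_)
import Data.Vec.Functional as VF
open import Function using (_∘_; mk⇔)
open import Relation.Nullary using (Dec; yes; no; does; contradiction)
open import Relation.Nullary.Decidable using (T?; from-yes; ¬?; _→-dec_; dec-true; dec-false)
open import Relation.Binary.PropositionalEquality

IsColoring : ∀ {n} → Graph n → Map n → Set
IsColoring G σ = ∀ x y → adj G x y ≡ true → FAdj (σ x) (σ y) ≡ true

all⁻ : ∀ {A : Set} (p : A → Bool) {xs : List A} → all p xs ≡ true → ∀ {x} → x ∈ xs → p x ≡ true
all⁻ p {y ∷ _} holds x∈xs with p y in py
all⁻ p {y ∷ _} holds (here refl)  | true = py
all⁻ p {y ∷ _} holds (there x∈xs) | true = all⁻ p holds x∈xs

all⁺ : ∀ {A : Set} (p : A → Bool) (xs : List A) → (∀ x → p x ≡ true) → all p xs ≡ true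
all⁺ p []       holds = refl
all⁺ p (y ∷ ys) holds rewrite holds y = all⁺ p ys holds

not-∨⁻ : ∀ {a b} → not a ∨ b ≡ true → a ≡ true → b ≡ true
not-∨⁻ {true} b≡true refl = b≡true

not-∨⁺ : ∀ a {b} → (a ≡ true → b ≡ true) → not a ∨ b ≡ true
not-∨⁺ true  a⇒b = a⇒b refl
not-∨⁺ false a⇒b = refl

isColoring⇒IsColoring : ∀ {n} (G : Graph n) σ → isColoring G σ ≡ true → IsColoring G σ
isColoring⇒IsColoring G σ col x y xy∈G =
  not-∨⁻ (all⁻ _ (all⁻ _ col (∈-allFin x)) (∈-allFin y)) xy∈G

IsColoring⇒isColoring : ∀ {n} (G : Graph n) σ → IsColoring G σ → isColoring G σ ≡ true
IsColoring⇒isColoring {n} G σ col =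
  all⁺ _ (allFin n) λ x → all⁺ _ (allFin n) λ y → not-∨⁺ (adj G x y) (col x y)

IsColoring-resp-≗ : ∀ {n} (G : Graph n) {σ τ : Map n} → σ ≗ τ → IsColoring G τ → IsColoring G σ
IsColoring-resp-≗ G σ≗τ col x y xy∈G =
  subst₂ (λ u v → FAdj u v ≡ true) (sym (σ≗τ x)) (sym (σ≗τ y)) (col x y xy∈G)

∈-allMaps : ∀ n (τ : Map n) → ∃ λ σ → σ ∈ allMaps n × σ ≗ τ
∈-allMaps zero    τ = _ , here refl , λ ()
∈-allMaps (suc n) τ with ∈-allMaps n (τ ∘ Fin.suc)
... | σ , σ∈ , σ≗τ =
  τ Fin.zero VF.∷ σ , ∈-concatMap⁺ extensions (Any.map extends (∈-allFin (τ Fin.zero))) , ≗-cons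
  where
  extensions : VF → List (Map (suc n))
  extensions v = map (v VF.∷_) (allMaps n)

  extends : ∀ {v} → τ Fin.zero ≡ v → τ Fin.zero VF.∷ σ ∈ extensions v
  extends refl = ∈-map⁺ (τ Fin.zero VF.∷_) σ∈

  ≗-cons : τ Fin.zero VF.∷ σ ≗ τ
  ≗-cons Fin.zero    = refl
  ≗-cons (Fin.suc i) = σ≗τ i

numColorings-pos : ∀ {n} (G : Graph n) → FColorable G → 0 < numColorings G
numColorings-pos {n} G (τ , τ-col) with ∈-allMaps n τ
... | σ , σ∈ , σ≗τ = ∈-length (∈-filter⁺ (λ σ → T? (isColoring G σ)) σ∈ σ-col)
  where
  σ-col : T (isColoring G σ)
  σ-col rewrite IsColoring⇒isColoring G σ
                  (IsColoring-resp-≗ G σ≗τ (isColoring⇒IsColoring G τ τ-col)) = _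

1/suc≢0 : ∀ k → + 1 / suc k ≢ 0ℚ
1/suc≢0 k 1/suc≡0 with ↥-/ (+ 1) (suc k)
... | ↥[1/suc]·gcd≡1 rewrite 1/suc≡0 = contradiction ↥[1/suc]·gcd≡1 λ ()

π-nonColoring : ∀ {n} (G : Graph n) σ → isColoring G σ ≡ false → π G σ ≡ 0ℚ
π-nonColoring G σ σ-bad with numColorings G
... | zero  = refl
... | suc k rewrite σ-bad = refl

π-coloring≢0 : ∀ {n} (G : Graph n) σ → 0 < numColorings G → isColoring G σ ≡ true → π G σ ≢ 0ℚ
π-coloring≢0 G σ pos σ-col with numColorings G
... | suc k rewrite σ-col = 1/suc≢0 k

π≗⇒IsColoring⊆ : ∀ {n} (G H : Graph n) → FColorable H → π G ≗ π H →
                 ∀ σ → IsColoring H σ → IsColoring G σ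
π≗⇒IsColoring⊆ G H H-col π≗ σ σ-col = isColoring⇒IsColoring G σ σ-colG
  where
  σ-colG : isColoring G σ ≡ true
  σ-colG with isColoring G σ in σ-bad
  ... | true  = refl
  ... | false = contradiction (trans (sym (π≗ σ)) (π-nonColoring G σ σ-bad))
                  (π-coloring≢0 H σ (numColorings-pos H H-col) (IsColoring⇒isColoring H σ σ-col))

FAdj-irrefl : ∀ v → FAdj v v ≡ false
FAdj-irrefl = from-yes (all? λ v → FAdj v v Bool.≟ false)

FAdj-sym : ∀ u v → FAdj u v ≡ FAdj v u
FAdj-sym = from-yes (all? λ u → all? λ v → FAdj u v Bool.≟ FAdj v u)

toK₃ : VF → Fin 3
toK₃ v = if toℕ v <ᵇ 32 then # 0 else if (toℕ v ≡ᵇ 32) ∨ (toℕ v ≡ᵇ 34) then # 1 else # 2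

toK₃-hom : ∀ u v → FAdj u v ≡ true → toK₃ u ≢ toK₃ v
toK₃-hom = from-yes (all? λ u → all? λ v → (FAdj u v Bool.≟ true) →-dec ¬? (toK₃ u ≟ toK₃ v))

triangle : Fin 3 → Fin 3 → Fin 3 → VF
triangle a b p = if does (p ≟ a) then # 33 else if does (p ≟ b) then # 34 else # 0

triangle-adj : ∀ a b p q → a ≢ b → p ≢ q → FAdj (triangle a b p) (triangle a b q) ≡ true
triangle-adj = from-yes (all? λ a → all? λ b → all? λ p → all? λ q →
  ¬? (a ≟ b) →-dec ¬? (p ≟ q) →-dec (FAdj (triangle a b p) (triangle a b q) Bool.≟ true))

4-adj-triangle : ∀ a b q → q ≢ a → FAdj (# 35) (triangle a b q) ≡ true
4-adj-triangle = from-yes (all? λ a → all? λ b → all? λ q →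
  ¬? (q ≟ a) →-dec (FAdj (# 35) (triangle a b q) Bool.≟ true))

1-adj-triangle : ∀ a b q → q ≢ b → FAdj (# 32) (triangle a b q) ≡ true
1-adj-triangle = from-yes (all? λ a → all? λ b → all? λ q →
  ¬? (q ≟ b) →-dec (FAdj (# 32) (triangle a b q) Bool.≟ true))

adj⇒≢ : ∀ {n} (H : Graph n) {u w} → adj H u w ≡ true → u ≢ w
adj⇒≢ H {u} uw∈H refl = contradiction (trans (sym uw∈H) (irref H u)) λ ()

module Separation {n} (H : Graph n) (c : Fin n → Fin 3)
                  (c-proper : ∀ u w → adj H u w ≡ true → c u ≢ c w)
                  (x y : Fin n) (xy∉H : adj H x y ≡ false) where

  yx∉H : adj H y x ≡ false
  yx∉H = trans (Graph.sym H y x) xy∉H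

  module _ (cx≢cy : c x ≢ c y) where

    recolor : Map n
    recolor v =
      if does (v ≟ x) then # 35 else if does (v ≟ y) then # 32 else triangle (c x) (c y) (c v)

    recolor-x : recolor x ≡ # 35
    recolor-x rewrite dec-true (x ≟ x) refl = refl

    recolor-y : recolor y ≡ # 32
    recolor-y rewrite dec-false (y ≟ x) (cx≢cy ∘ cong c ∘ sym) | dec-true (y ≟ y) refl = refl

    recolor-other : ∀ {v} → v ≢ x → v ≢ y → recolor v ≡ triangle (c x) (c y) (c v)
    recolor-other {v} v≢x v≢y rewrite dec-false (v ≟ x) v≢x | dec-false (v ≟ y) v≢y = refl

    recolor-adj : ∀ u w → adj H u w ≡ true → w ≢ x → w ≢ y → FAdj (recolor u) (recolor w) ≡ true
    recolor-adj u w uw∈H w≢x w≢y rewrite recolor-other w≢x w≢y with u ≟ x | u ≟ y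
    ... | yes refl | _        = 4-adj-triangle (c x) (c y) (c w) (c-proper x w uw∈H ∘ sym)
    ... | no _     | yes refl = 1-adj-triangle (c x) (c y) (c w) (c-proper y w uw∈H ∘ sym)
    ... | no _     | no _     = triangle-adj (c x) (c y) (c u) (c w) cx≢cy (c-proper u w uw∈H)

    recolor-adj-to : ∀ z → z ≡ x ⊎ z ≡ y → ∀ u → adj H u z ≡ true →
                     FAdj (recolor u) (recolor z) ≡ true
    recolor-adj-to .x (inj₁ refl) u ux∈H =
      trans (FAdj-sym (recolor u) (recolor x))
            (recolor-adj x u (trans (Graph.sym H x u) ux∈H) (adj⇒≢ H ux∈H) u≢y)
      where
      u≢y : u ≢ y
      u≢y refl = contradiction (trans (sym ux∈H) yx∉H) λ ()
    recolor-adj-to .y (inj₂ refl) u uy∈H =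
      trans (FAdj-sym (recolor u) (recolor y))
            (recolor-adj y u (trans (Graph.sym H y u) uy∈H) u≢x (adj⇒≢ H uy∈H))
      where
      u≢x : u ≢ x
      u≢x refl = contradiction (trans (sym uy∈H) xy∉H) λ ()

    recolor-isColoring : IsColoring H recolor
    recolor-isColoring u w uw∈H = by-cases (w ≟ x) (w ≟ y)
      where
      by-cases : Dec (w ≡ x) → Dec (w ≡ y) → FAdj (recolor u) (recolor w) ≡ true
      by-cases (no w≢x)  (no w≢y)  = recolor-adj u w uw∈H w≢x w≢y
      by-cases (yes w≡x) _         = recolor-adj-to w (inj₁ w≡x) u uw∈H
      by-cases (no _)    (yes w≡y) = recolor-adj-to w (inj₂ w≡y) u uw∈H

    recolor-separates : FAdj (recolor x) (recolor y) ≡ false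
    recolor-separates rewrite recolor-x | recolor-y = refl

  K₃↪F : Fin 3 → VF
  K₃↪F = triangle (# 0) (# 1)

  K₃↪F∘c-isColoring : IsColoring H (K₃↪F ∘ c)
  K₃↪F∘c-isColoring u w uw∈H = triangle-adj (# 0) (# 1) (c u) (c w) (λ ()) (c-proper u w uw∈H)

  separatingColoring : ∃ λ σ → IsColoring H σ × FAdj (σ x) (σ y) ≡ false
  separatingColoring with c x ≟ c y
  ... | yes cx≡cy = K₃↪F ∘ c , K₃↪F∘c-isColoring
                  , trans (cong (FAdj (K₃↪F (c x)) ∘ K₃↪F) (sym cx≡cy)) (FAdj-irrefl (K₃↪F (c x)))
  ... | no cx≢cy  = recolor cx≢cy , recolor-isColoring cx≢cy , recolor-separates cx≢cy

FColorable⇒separatingColoring : ∀ {n} (H : Graph n) → FColorable H →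
                                ∀ x y → adj H x y ≡ false →
                                ∃ λ σ → IsColoring H σ × FAdj (σ x) (σ y) ≡ false
FColorable⇒separatingColoring H (τ , τ-col) =
  Separation.separatingColoring H (toK₃ ∘ τ) toK₃∘τ-proper
  where
  toK₃∘τ-proper : ∀ u w → adj H u w ≡ true → toK₃ (τ u) ≢ toK₃ (τ w)
  toK₃∘τ-proper u w uw∈H = toK₃-hom (τ u) (τ w) (isColoring⇒IsColoring H τ τ-col u w uw∈H)

π≗⇒adj⊆ : ∀ {n} (G H : Graph n) → FColorable H → π G ≗ π H →
          ∀ x y → adj G x y ≡ true → adj H x y ≡ true
π≗⇒adj⊆ G H H-col π≗ x y xy∈G with adj H x y in xy∈H
... | true  = refl
... | false with FColorable⇒separatingColoring H H-col x y xy∈H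
...   | σ , σ-col , σxy∉F =
  contradiction (trans (sym (π≗⇒IsColoring⊆ G H H-col π≗ σ σ-col x y xy∈G)) σxy∉F) λ ()

lemma4 : Identifiable
lemma4 n G₁ G₂ G₁-col G₂-col G₁≢G₂ π≗ = G₁≢G₂ λ x y →
  Bool.⇔→≡ (mk⇔ (π≗⇒adj⊆ G₁ G₂ G₂-col π≗ x y)
                 (π≗⇒adj⊆ G₂ G₁ G₁-col (sym ∘ π≗) x y))
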